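{- Let $n\ge 45$ and $m=\lfloor\frac{n-8}{2}\rfloor$. Then there are $n$ words $\ell_1,\dots,\ell_n\in\{l,r\}^m$ such that: (1) any two distinct of them differ in at least four positions; (2) each contains at least one block of length at least two which is not its last block; (3) each contains at least three blocks.
   Context: For a word $w$ over the alphabet $\{l,r\}$, its blocks are its maximal runs of consecutive equal letters; e.g. $lllrrrlllrl$ has the blocks $lll\,|\,rrr\,|\,lll\,|\,r\,|\,l$, and the last block is the rightmost one. -}

module Defs where

open import Data.Nat using (ℕ; zero; suc; _+_; _≤_)
open import Data.Bool using (Bool; true; false; if_then_else_)
open import Data.List using (List; []; _∷_; length)
open import Data.Vec using (Vec; toList)
open import Data.List.Relation.Unary.Any using (Any; here; there)

data Letter : Set where
  l r : Letter

eqL : Letter → Letter → Bool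
eqL l l = true
eqL r r = true
eqL _ _ = false

Word : ℕ → Set
Word m = Vec Letter m

hamming : ∀ {m} → Word m → Word m → ℕ
hamming Data.Vec.[] Data.Vec.[] = 0
hamming (a Data.Vec.∷ u) (b Data.Vec.∷ v) =
  (if eqL a b then 0 else 1) + hamming u v

-- Blocks (maximal runs of equal letters), left to right, as (letter, length) pairs
-- with each length ≥ 1.
record Block : Set where
  constructor blk
  field
    letter : Letter
    len    : ℕ

open Block public

consBlocks : Letter → List Block → List Block
consBlocks a [] = blk a 1 ∷ []
consBlocks a (blk b k ∷ bs) =
  if eqL a b then blk b (suc k) ∷ bs else blk a 1 ∷ blk b k ∷ bs

blocksL : List Letter → List Block
blocksL [] = []
blocksL (a ∷ w) = consBlocks a (blocksL w)

blocks : ∀ {m} → Word m → List Block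
blocks w = blocksL (toList w)

initBlocks : List Block → List Block
initBlocks [] = []
initBlocks (b ∷ []) = []
initBlocks (b ∷ c ∷ bs) = b ∷ initBlocks (c ∷ bs)

HasLongNonLastBlock : ∀ {m} → Word m → Set
HasLongNonLastBlock w = Any (λ b → 2 ≤ len b) (initBlocks (blocks w))

{-# OPTIONS --safe #-}
-- Write i < n ≤ 2^k in binary with k letters and append a parity letter: distinct
-- codewords now differ in at least two places. Doubling every letter makes that four,
-- and the prefix llrl, whose blocks are ll | r | l…, supplies a long non-last block and
-- three blocks; padding with l reaches length m whenever 6 + 2k ≤ m. Writing
-- n = 45 + s + 4t with s < 4, the choice k = 6 + t works, since n ≤ 48 + 4t ≤ 2^(6+t).
module Submission where

open import Defs
open import Data.Nat using (ℕ; zero; suc; _+_; _*_; _^_; _≤_; _<_; _∸_; _/_; _%_; z≤n; s≤s; s≤s⁻¹)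
open import Data.Nat.Properties
open import Data.Nat.Tactic.RingSolver using (solve-∀)
open import Data.Nat.DivMod using (m≡m%n+[m/n]*n; m%n<n; m*n/n≡m; /-monoˡ-≤)
open import Data.Bool using (if_then_else_)
open import Data.Fin using (Fin; zero; suc; inject≤; remQuot; quotient; remainder; combine)
open import Data.Fin.Properties using (combine-remQuot; inject≤-injective)
open import Data.List using ([]; _∷_; length)
open import Data.List.Relation.Unary.Any using (here)
open import Data.Vec using ([]; _∷_; _++_; replicate)
open import Data.Vec.Properties using (∷-injectiveˡ; ∷-injectiveʳ)
open import Data.Product using (Σ; _×_; _,_; ∃₂; uncurry)
open import Data.Empty using (⊥-elim)
open import Function using (_∘_)
open import Relation.Binary.PropositionalEquality
  using (_≡_; _≢_; refl; sym; trans; cong; cong₂; subst; module ≡-Reasoning)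

mismatch : Letter → Letter → ℕ
mismatch a b = if eqL a b then 0 else 1

≢⇒mismatch≡1 : ∀ {a b} → a ≢ b → mismatch a b ≡ 1
≢⇒mismatch≡1 {l} {l} a≢b = ⊥-elim (a≢b refl)
≢⇒mismatch≡1 {l} {r} _   = refl
≢⇒mismatch≡1 {r} {l} _   = refl
≢⇒mismatch≡1 {r} {r} a≢b = ⊥-elim (a≢b refl)

hamming≡0⇒≡ : ∀ {k} {u v : Word k} → hamming u v ≡ 0 → u ≡ v
hamming≡0⇒≡ {u = []}    {[]}    _  = refl
hamming≡0⇒≡ {u = l ∷ u} {l ∷ v} eq = cong (l ∷_) (hamming≡0⇒≡ eq)
hamming≡0⇒≡ {u = r ∷ u} {r ∷ v} eq = cong (r ∷_) (hamming≡0⇒≡ eq)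

hamming-++ : ∀ {j k} (u v : Word j) (u′ v′ : Word k) →
             hamming (u ++ u′) (v ++ v′) ≡ hamming u v + hamming u′ v′
hamming-++ []      []      u′ v′ = refl
hamming-++ (a ∷ u) (b ∷ v) u′ v′ =
  trans (cong (mismatch a b +_) (hamming-++ u v u′ v′)) (sym (+-assoc (mismatch a b) _ _))

double : ∀ {k} → Word k → Word (k * 2)
double []      = []
double (a ∷ u) = a ∷ a ∷ double u

hamming-double : ∀ {k} (u v : Word k) → hamming (double u) (double v) ≡ 2 * hamming u v
hamming-double []      []      = refl
hamming-double (a ∷ u) (b ∷ v) = begin
  δ + (δ + hamming (double u) (double v)) ≡⟨ cong ((δ +_) ∘ (δ +_)) (hamming-double u v) ⟩
  δ + (δ + 2 * hamming u v)               ≡⟨ regroup δ (hamming u v) ⟩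
  2 * (δ + hamming u v)                   ∎
  where
  open ≡-Reasoning
  δ = mismatch a b
  regroup : ∀ x y → x + (x + 2 * y) ≡ 2 * (x + y)
  regroup = solve-∀

flip : Letter → Letter
flip l = r
flip r = l

flip-injective : ∀ {a b} → flip a ≡ flip b → a ≡ b
flip-injective {l} {l} _ = refl
flip-injective {r} {r} _ = refl

flip-¬ : ∀ {a b} → a ≡ b → a ≢ flip b
flip-¬ {l} refl ()
flip-¬ {r} refl ()

parity : ∀ {k} → Word k → Letter
parity []      = l
parity (l ∷ u) = parity u
parity (r ∷ u) = flip (parity u)

withParity : ∀ {k} → Word k → Word (suc k)
withParity u = parity u ∷ u

hamming≡1⇒parity≢ : ∀ {k} (u v : Word k) → hamming u v ≡ 1 → parity u ≢ parity v
hamming≡1⇒parity≢ []      []      ()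
hamming≡1⇒parity≢ (l ∷ u) (l ∷ v) eq = hamming≡1⇒parity≢ u v eq
hamming≡1⇒parity≢ (r ∷ u) (r ∷ v) eq = hamming≡1⇒parity≢ u v eq ∘ flip-injective
hamming≡1⇒parity≢ (l ∷ u) (r ∷ v) eq =
  flip-¬ (cong parity (hamming≡0⇒≡ {u = u} {v} (suc-injective eq)))
hamming≡1⇒parity≢ (r ∷ u) (l ∷ v) eq =
  flip-¬ (sym (cong parity (hamming≡0⇒≡ {u = u} {v} (suc-injective eq)))) ∘ sym

withParity-separates : ∀ {k} {u v : Word k} → u ≢ v →
                       2 ≤ hamming (withParity u) (withParity v)
withParity-separates {u = u} {v} u≢v with hamming u v in eq
... | 0           = ⊥-elim (u≢v (hamming≡0⇒≡ eq))
... | 1           rewrite ≢⇒mismatch≡1 (hamming≡1⇒parity≢ u v eq) = ≤-refl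
... | suc (suc h) = ≤-trans (m≤m+n 2 h) (m≤n+m _ (mismatch (parity u) (parity v)))

remQuot-injective : ∀ {m} n {i j : Fin (m * n)} → remQuot {m} n i ≡ remQuot n j → i ≡ j
remQuot-injective {m} n {i} {j} eq = begin
  i                                 ≡⟨ sym (combine-remQuot {m} n i) ⟩
  uncurry combine (remQuot {m} n i) ≡⟨ cong (uncurry combine) eq ⟩
  uncurry combine (remQuot {m} n j) ≡⟨ combine-remQuot {m} n j ⟩
  j                                 ∎
  where open ≡-Reasoning

bit : Fin 2 → Letter
bit zero       = l
bit (suc zero) = r

bit-injective : ∀ {x y} → bit x ≡ bit y → x ≡ y
bit-injective {zero}     {zero}     _ = refl
bit-injective {suc zero} {suc zero} _ = refl
bit-injective {zero}     {suc zero} ()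
bit-injective {suc zero} {zero}     ()

binary : ∀ k → Fin (2 ^ k) → Word k
binary zero    _ = []
binary (suc k) i = bit (quotient (2 ^ k) i) ∷ binary k (remainder {2} (2 ^ k) i)

binary-injective : ∀ k {i j} → binary k i ≡ binary k j → i ≡ j
binary-injective zero    {zero} {zero} _ = refl
binary-injective (suc k) eq = remQuot-injective {2} (2 ^ k)
  (cong₂ _,_ (bit-injective (∷-injectiveˡ eq)) (binary-injective k (∷-injectiveʳ eq)))

consBlocks-head : ∀ a bs → ∃₂ λ k bs′ → consBlocks a bs ≡ blk a k ∷ bs′
consBlocks-head a []            = 1 , [] , refl
consBlocks-head l (blk l k ∷ bs) = suc k , bs , refl
consBlocks-head l (blk r k ∷ bs) = 1 , blk r k ∷ bs , refl
consBlocks-head r (blk l k ∷ bs) = 1 , blk l k ∷ bs , refl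
consBlocks-head r (blk r k ∷ bs) = suc k , bs , refl

blocks-llrl : ∀ {m} (w : Word m) →
              ∃₂ λ k bs → blocks (l ∷ l ∷ r ∷ l ∷ w) ≡ blk l 2 ∷ blk r 1 ∷ blk l k ∷ bs
blocks-llrl w with consBlocks-head l (blocks w)
... | k , bs , eq rewrite eq = k , bs , refl

llrl-hasLongNonLastBlock : ∀ {m} (w : Word m) → HasLongNonLastBlock (l ∷ l ∷ r ∷ l ∷ w)
llrl-hasLongNonLastBlock w with blocks-llrl w
... | _ , _ , eq rewrite eq = here ≤-refl

llrl-three≤#blocks : ∀ {m} (w : Word m) → 3 ≤ length (blocks (l ∷ l ∷ r ∷ l ∷ w))
llrl-three≤#blocks w with blocks-llrl w
... | _ , _ , eq rewrite eq = s≤s (s≤s (s≤s z≤n))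

AdmissibleFamily : ℕ → ℕ → Set
AdmissibleFamily n m = Σ (Fin n → Word m) λ ℓ →
  ((i j : Fin n) → i ≢ j → 4 ≤ hamming (ℓ i) (ℓ j))
  × ((i : Fin n) → HasLongNonLastBlock (ℓ i))
  × ((i : Fin n) → 3 ≤ length (blocks (ℓ i)))

admissibleFamily : ∀ {n m} k → n ≤ 2 ^ k → 6 + k * 2 ≤ m → AdmissibleFamily n m
admissibleFamily {n} k n≤2^k 6+2k≤m with m≤n⇒∃[o]m+o≡n 6+2k≤m
... | p , refl = ℓ , separated , llrl-hasLongNonLastBlock ∘ body , llrl-three≤#blocks ∘ body
  where
  codeword : Fin n → Word (suc k)
  codeword i = withParity (binary k (inject≤ i n≤2^k))

  pad : Word p
  pad = replicate p l

  body : Fin n → Word (suc k * 2 + p)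
  body i = double (codeword i) ++ pad

  ℓ : Fin n → Word (6 + k * 2 + p)
  ℓ i = l ∷ l ∷ r ∷ l ∷ body i

  codeword-separated : ∀ {i j} → i ≢ j → 2 ≤ hamming (codeword i) (codeword j)
  codeword-separated i≢j =
    withParity-separates (i≢j ∘ inject≤-injective _ _ _ _ ∘ binary-injective k)

  separated : (i j : Fin n) → i ≢ j → 4 ≤ hamming (ℓ i) (ℓ j)
  separated i j i≢j = begin
    4
      ≤⟨ *-monoʳ-≤ 2 (codeword-separated i≢j) ⟩
    2 * hamming (codeword i) (codeword j)
      ≡⟨ hamming-double (codeword i) (codeword j) ⟨
    hamming (double (codeword i)) (double (codeword j))
      ≤⟨ m≤m+n _ _ ⟩
    hamming (double (codeword i)) (double (codeword j)) + hamming pad pad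
      ≡⟨ hamming-++ (double (codeword i)) (double (codeword j)) pad pad ⟨
    hamming (ℓ i) (ℓ j)
      ∎
    where open ≤-Reasoning

48+t*4≤2^[6+t] : ∀ t → 48 + t * 4 ≤ 2 ^ (6 + t)
48+t*4≤2^[6+t] zero    = m≤m+n 48 16
48+t*4≤2^[6+t] (suc t) = begin
  4 + (48 + t * 4)          ≤⟨ +-mono-≤ (≤-trans (m≤m+n 4 (44 + t * 4)) ih) ih ⟩
  2 ^ (6 + t) + 2 ^ (6 + t) ≡⟨ cong (2 ^ (6 + t) +_) (+-identityʳ (2 ^ (6 + t))) ⟨
  2 ^ (7 + t)               ∎
  where
  open ≤-Reasoning
  ih = 48+t*4≤2^[6+t] t

admissibleFamily-45+[s+t*4] : ∀ s t → s < 4 →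
  AdmissibleFamily (45 + (s + t * 4)) ((37 + (s + t * 4)) / 2)
admissibleFamily-45+[s+t*4] s t s<4 = admissibleFamily (6 + t) size fits
  where
  size : 45 + (s + t * 4) ≤ 2 ^ (6 + t)
  size = ≤-trans (+-monoʳ-≤ 45 (+-monoˡ-≤ (t * 4) (s≤s⁻¹ s<4))) (48+t*4≤2^[6+t] t)

  fits : 18 + t * 2 ≤ (37 + (s + t * 4)) / 2
  fits = begin
    18 + t * 2               ≡⟨ sym (m*n/n≡m (18 + t * 2) 2) ⟩
    (36 + t * 2 * 2) / 2     ≤⟨ /-monoˡ-≤ 2 (m≤n⇒m≤1+n (+-monoʳ-≤ 36 t*2*2≤s+t*4)) ⟩
    (37 + (s + t * 4)) / 2   ∎
    where
    open ≤-Reasoning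
    t*2*2≤s+t*4 : t * 2 * 2 ≤ s + t * 4
    t*2*2≤s+t*4 = ≤-trans (≤-reflexive (*-assoc t 2 2)) (m≤n+m (t * 4) s)

lemma3p7 : (n : ℕ) → 45 ≤ n →
    Σ (Fin n → Word ((n ∸ 8) / 2)) λ ℓ →
      ((i j : Fin n) → i ≢ j → 4 ≤ hamming (ℓ i) (ℓ j))
      × ((i : Fin n) → HasLongNonLastBlock (ℓ i))
      × ((i : Fin n) → 3 ≤ length (blocks (ℓ i)))
lemma3p7 n 45≤n =
  subst (λ n → AdmissibleFamily n ((n ∸ 8) / 2)) 45+[s+t*4]≡n
    (admissibleFamily-45+[s+t*4] s t (m%n<n q 4))
  where
  q = n ∸ 45
  s = q % 4
  t = q / 4
  45+[s+t*4]≡n : 45 + (s + t * 4) ≡ n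
  45+[s+t*4]≡n = trans (cong (45 +_) (sym (m≡m%n+[m/n]*n q 4))) (m+[n∸m]≡n 45≤n)
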